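{- Let $F$ be a graph with $d_2(F)>1$ and let $\ell\ge 3$. Suppose $F_1,\dots,F_\ell$, indexed by $\mathbb{Z}/\ell\mathbb{Z}$, are copies of $F$ such that no edge belongs to three of them and for all distinct $i,j\in\mathbb{Z}/\ell\mathbb{Z}$ we have $|E(F_i)\cap E(F_j)|=1$ if $j=i\pm1$ and $|E(F_i)\cap E(F_j)|=0$ otherwise. Then the union $\mathfrak{C}=\bigcup_{i\in\mathbb{Z}/\ell\mathbb{Z}}F_i$ satisfies $d_2(\mathfrak{C})>d_2(F)$.
   Context: For a graph $F$ with at least one edge, $d_2(F)=\frac{|E(F)|-1}{|V(F)|-2}$ if $|V(F)|\ge 3$ and $d_2(K_2)=1$. Copies of $F$ are graphs isomorphic to $F$; the union has vertex set $\bigcup V(F_i)$ and edge set $\bigcup E(F_i)$. -}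

module Defs where

open import Data.Nat using (ℕ; zero; suc; _<?_)
open import Data.Integer using (ℤ; +_; _-_)
open import Data.Rational using (ℚ; _/_; 1ℚ)
open import Data.Fin using (Fin; toℕ; _≟_)
open import Data.Bool using (Bool; true; false; _∧_; _∨_; if_then_else_)
open import Data.List using (List; allFin)
open import Data.Product using (_×_)
open import Data.Sum using (_⊎_)
open import Relation.Nullary.Decidable using (⌊_⌋)
open import Relation.Binary.PropositionalEquality using (_≡_)
open import Function.Definitions using (Injective)

record Graph : Set where
  field
    n       : ℕ
    adj     : Fin n → Fin n → Bool
    adj-sym : ∀ a b → adj a b ≡ adj b a
    adj-irr : ∀ a → adj a a ≡ false
open Graph public

anyL : {A : Set} → (A → Bool) → List A → Bool
anyL p List.[] = false
anyL p (x List.∷ xs) = p x ∨ anyL p xs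

countL : {A : Set} → (A → Bool) → List A → ℕ
countL p List.[] = 0
countL p (x List.∷ xs) = if p x then suc (countL p xs) else countL p xs

sumL : {A : Set} → (A → ℕ) → List A → ℕ
sumL f List.[] = 0
sumL f (x List.∷ xs) = f x Data.Nat.+ sumL f xs

countPairs : (m : ℕ) → (Fin m → Fin m → Bool) → ℕ
countPairs m p =
  sumL (λ u → countL (λ v → ⌊ toℕ u <? toℕ v ⌋ ∧ p u v) (allFin m)) (allFin m)

edgeCount : Graph → ℕ
edgeCount F = countPairs (n F) (adj F)

-- d₂ from the number of vertices v and edges e:
-- (e - 1)/(v - 2) if v ≥ 3, and 1 for K₂ (the only graph with ≤ 2 vertices and an edge).
d₂ : ℕ → ℕ → ℚ
d₂ (suc (suc (suc k))) e = ((+ e) - (+ 1)) / suc k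
d₂ _ e = 1ℚ

d₂G : Graph → ℚ
d₂G F = d₂ (n F) (edgeCount F)

-- A copy of F in the ambient vertex set Fin N: an injective vertex map;
-- its vertex set is the image, its edge set the image of E(F).
Embedding : Graph → ℕ → Set
Embedding F N = Σ (Fin (n F) → Fin N) (Injective _≡_ _≡_)
  where open import Data.Product using (Σ)

copyAdj : (F : Graph) {N : ℕ} → (Fin (n F) → Fin N) → Fin N → Fin N → Bool
copyAdj F φ u v =
  anyL (λ a → anyL (λ b → adj F a b ∧ ⌊ φ a ≟ u ⌋ ∧ ⌊ φ b ≟ v ⌋) (allFin (n F))) (allFin (n F))

copyVtx : (F : Graph) {N : ℕ} → (Fin (n F) → Fin N) → Fin N → Bool
copyVtx F φ w = anyL (λ a → ⌊ φ a ≟ w ⌋) (allFin (n F))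

commonEdges : (F : Graph) {N : ℕ} → (Fin (n F) → Fin N) → (Fin (n F) → Fin N) → ℕ
commonEdges F {N} φ ψ = countPairs N (λ u v → copyAdj F φ u v ∧ copyAdj F ψ u v)

unionVertices : (F : Graph) {N ℓ : ℕ} → (Fin ℓ → Fin (n F) → Fin N) → ℕ
unionVertices F {N} {ℓ} φ = countL (λ w → anyL (λ i → copyVtx F (φ i) w) (allFin ℓ)) (allFin N)

unionEdges : (F : Graph) {N ℓ : ℕ} → (Fin ℓ → Fin (n F) → Fin N) → ℕ
unionEdges F {N} {ℓ} φ = countPairs N (λ u v → anyL (λ i → copyAdj F (φ i) u v) (allFin ℓ))

-- j ≡ i + 1 in ℤ/ℓℤ (indices represented by Fin ℓ)
IsSucc : (ℓ : ℕ) → Fin ℓ → Fin ℓ → Set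
IsSucc ℓ i j = (toℕ j ≡ suc (toℕ i)) ⊎ ((suc (toℕ i) ≡ ℓ) × (toℕ j ≡ 0))

CycAdj : (ℓ : ℕ) → Fin ℓ → Fin ℓ → Set
CycAdj ℓ i j = IsSucc ℓ i j ⊎ IsSucc ℓ j i

{-# OPTIONS --safe #-}
module Submission where

-- Let v and e be the numbers of vertices and edges of F. Vertices and edges are both counted
-- by functions μ with μ (p ∪ q) + μ (p ∩ q) = μ p + μ q, so a union of sets can be estimated
-- by adding the sets one at a time and accounting for each overlap. Consecutive copies share
-- an edge, hence two vertices, and F₀ meets F₁ ∪ … ∪ F_{ℓ-1} in two distinct edges (no edge
-- lies in three copies), hence in at least three vertices; so |V(C)| ≤ ℓ (v - 2) + 1.
-- Non-consecutive copies share no edge, so adding F₀ last loses at most two edges and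
-- |E(C)| ≥ ℓ (e - 1). Finally (ℓ (e - 1) - 1) / (ℓ (v - 2) - 1) > (e - 1) / (v - 2) is
-- equivalent to e - 1 > v - 2, that is, to d₂(F) > 1.

open import Defs
open import Data.Bool using (Bool; true; false; _∧_; _∨_; T)
open import Data.Bool.Properties using (∧-zeroʳ)
open import Data.Empty using (⊥-elim)
open import Data.Fin using (Fin; zero; suc; toℕ; inject₁; fromℕ; punchIn; punchOut; _≟_)
open import Data.Fin.Properties
  using (toℕ-injective; toℕ-inject₁; toℕ-fromℕ; punchIn-punchOut; punchInᵢ≢i; punchOut-injective)
  renaming (suc-injective to suc-injectiveᶠ; <⇒≢ to <⇒≢ᶠ)
open import Data.Integer as ℤ using (-[1+_]; +<+)
open import Data.Integer.Properties using (pos-*; drop‿+<+)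
open import Data.List using ([]; _∷_; tabulate; allFin)
open import Data.Nat as ℕ using (ℕ; zero; suc; _+_; _*_; _≤_; z≤n; s≤s; _<?_)
open import Data.Nat.Properties hiding (_≟_)
open import Data.Nat.Tactic.RingSolver using (solve; solve-∀)
open import Data.Product using (∃; ∃₂; _×_; _,_; uncurry; proj₁; proj₂)
open import Data.Rational using (_/_; _<_; 1ℚ)
open import Data.Rational.Properties using (toℚᵘ-fromℚᵘ; toℚᵘ-mono-<; toℚᵘ-cancel-<)
  renaming (<-irrefl to <-irreflℚ)
open import Data.Rational.Unnormalised using (mkℚᵘ; *<*)
open import Data.Rational.Unnormalised.Properties using (<-respˡ-≃; <-respʳ-≃; ≃-sym)
open import Data.Sum using (inj₁; inj₂)
open import Data.Unit using (tt)
open import Function using (_∘_; id)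
open import Function.Definitions using (Injective)
open import Relation.Binary.PropositionalEquality
open import Relation.Nullary using (¬_; Dec; yes; no)
open import Relation.Nullary.Decidable using (⌊_⌋; toWitness; fromWitness)

open import Algebra.Properties.Semiring.Sum +-*-semiring
  using (sum; sum-syntax; sum-cong-≗; sum-replicate-zero; sum-remove; ∑-distrib-+; ∑-comm)

sum-mono-≤ : ∀ {n} {f g : Fin n → ℕ} → (∀ i → f i ≤ g i) → sum f ≤ sum g
sum-mono-≤ {zero}  f≤g = z≤n
sum-mono-≤ {suc n} f≤g = +-mono-≤ (f≤g zero) (sum-mono-≤ (f≤g ∘ suc))

sum-zero : ∀ {n} {f : Fin n → ℕ} → (∀ i → f i ≡ 0) → sum f ≡ 0
sum-zero {n} f≗0 = trans (sum-cong-≗ f≗0) (sum-replicate-zero n)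

sum-single : ∀ {n} {f : Fin (suc n) → ℕ} i → (∀ j → j ≢ i → f j ≡ 0) → sum f ≡ f i
sum-single {f = f} i others≡0 = begin
  sum f                             ≡⟨ sum-remove f ⟩
  f i + sum (λ j → f (punchIn i j)) ≡⟨ cong (f i +_) (sum-zero (λ j → others≡0 _ (punchInᵢ≢i i j))) ⟩
  f i + 0                           ≡⟨ +-identityʳ (f i) ⟩
  f i                               ∎
  where open ≡-Reasoning

sum-positive : ∀ {n} (f : Fin n → ℕ) → 0 ℕ.< sum f → ∃ λ i → 0 ℕ.< f i
sum-positive {suc n} f 0<∑ with f zero in eq
... | suc _ = zero , subst (0 ℕ.<_) (sym eq) (s≤s z≤n)
... | zero  with sum-positive (f ∘ suc) 0<∑
...   | i , 0<fᵢ = suc i , 0<fᵢ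

sum-∘-injective-≤ : ∀ {m n} (g : Fin n → ℕ) {f : Fin m → Fin n} → Injective _≡_ _≡_ f →
                    sum (g ∘ f) ≤ sum g
sum-∘-injective-≤ {zero}          g f-inj = z≤n
sum-∘-injective-≤ {suc m} {zero}  g {f} f-inj with f zero
... | ()
sum-∘-injective-≤ {suc m} {suc n} g {f} f-inj = begin
  g (f zero) + sum (g ∘ f ∘ suc)                ≡⟨ cong (g (f zero) +_) (sum-cong-≗ (cong g ∘ sym ∘ punchIn-punchOut ∘ f₀≢f∘suc)) ⟩
  g (f zero) + sum (g ∘ punchIn (f zero) ∘ f′)  ≤⟨ +-monoʳ-≤ _ (sum-∘-injective-≤ (g ∘ punchIn (f zero)) f′-inj) ⟩
  g (f zero) + sum (g ∘ punchIn (f zero))       ≡⟨ sum-remove g ⟨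
  sum g                                         ∎
  where
  open ≤-Reasoning
  f₀≢f∘suc : ∀ a → f zero ≢ f (suc a)
  f₀≢f∘suc a eq with f-inj eq
  ... | ()
  -- f ∘ suc avoids f zero, so punching out f zero turns it into an injection into Fin n.
  f′ : Fin m → Fin n
  f′ a = punchOut (f₀≢f∘suc a)
  f′-inj : Injective _≡_ _≡_ f′
  f′-inj eq = suc-injectiveᶠ (f-inj (punchOut-injective (f₀≢f∘suc _) (f₀≢f∘suc _) eq))

∑-1 : ∀ n → ∑[ i < n ] 1 ≡ n
∑-1 zero    = refl
∑-1 (suc n) = cong suc (∑-1 n)

T-∧⁻ : ∀ a {b} → T (a ∧ b) → T a × T b
T-∧⁻ true t = tt , t

T-∧⁺ : ∀ {a b} → T a → T b → T (a ∧ b)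
T-∧⁺ {true} _ t = t

⋁ : ∀ {n} → (Fin n → Bool) → Bool
⋁ {zero}  p = false
⋁ {suc n} p = p zero ∨ ⋁ (p ∘ suc)

⋁-intro : ∀ {n} (p : Fin n → Bool) i → T (p i) → T (⋁ p)
⋁-intro p zero    t with p zero
... | true = tt
⋁-intro p (suc i) t with p zero
... | true  = tt
... | false = ⋁-intro (p ∘ suc) i t

⋁-elim : ∀ {n} (p : Fin n → Bool) → T (⋁ p) → ∃ λ i → T (p i)
⋁-elim {suc n} p t with p zero in eq
... | true  = zero , subst T (sym eq) tt
... | false with ⋁-elim (p ∘ suc) t
...   | i , tᵢ = suc i , tᵢ

module _ {X : Set} where

  ∅ : X → Bool
  ∅ _ = false

  infixr 6 _∩_
  infixr 5 _∪_
  _∪_ _∩_ : (X → Bool) → (X → Bool) → X → Bool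
  (p ∪ q) x = p x ∨ q x
  (p ∩ q) x = p x ∧ q x

  ⋃ : ∀ {k} → (Fin k → X → Bool) → X → Bool
  ⋃ B x = ⋁ (λ i → B i x)

  infix 4 _⊆_
  _⊆_ : (X → Bool) → (X → Bool) → Set
  p ⊆ q = ∀ x → T (p x) → T (q x)

  ∩-⊆ˡ : ∀ p q → p ∩ q ⊆ p
  ∩-⊆ˡ p q x t with p x
  ... | true = tt

  ∩-⊆ʳ : ∀ p q → p ∩ q ⊆ q
  ∩-⊆ʳ p q x t with p x
  ... | true = t

  ⊆-∩ : ∀ {p q r} → r ⊆ p → r ⊆ q → r ⊆ p ∩ q
  ⊆-∩ {p} r⊆p r⊆q x t with p x | r⊆p x t
  ... | true | _ = r⊆q x t

  ⊆-⋃ : ∀ {k} (B : Fin k → X → Bool) i → B i ⊆ ⋃ B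
  ⊆-⋃ B i x = ⋁-intro (λ j → B j x) i

  ∩-⋃-⊆ : ∀ {k} A (B : Fin k → X → Bool) → A ∩ ⋃ B ⊆ ⋃ (λ i → A ∩ B i)
  ∩-⋃-⊆ A B x t with A x
  ... | true with ⋁-elim (λ i → B i x) t
  ...   | i , tᵢ = ⋁-intro (λ j → B j x) i tᵢ

𝟙 : Bool → ℕ
𝟙 true  = 1
𝟙 false = 0

𝟙-mono : ∀ {a b} → (T a → T b) → 𝟙 a ≤ 𝟙 b
𝟙-mono {false}         _   = z≤n
𝟙-mono {true}  {true}  _   = ≤-refl
𝟙-mono {true}  {false} a⇒b = ⊥-elim (a⇒b tt)

𝟙-cong : ∀ {a b} → (T a → T b) → (T b → T a) → 𝟙 a ≡ 𝟙 b
𝟙-cong a⇒b b⇒a = ≤-antisym (𝟙-mono a⇒b) (𝟙-mono b⇒a)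

𝟙-positive : ∀ {b} → 0 ℕ.< 𝟙 b → T b
𝟙-positive {true} _ = tt

𝟙-⌊yes⌋ : ∀ {A : Set} (a? : Dec A) → A → 𝟙 ⌊ a? ⌋ ≡ 1
𝟙-⌊yes⌋ (yes _) _ = refl
𝟙-⌊yes⌋ (no ¬a) a = ⊥-elim (¬a a)

𝟙-⌊no⌋ : ∀ {A : Set} (a? : Dec A) → ¬ A → 𝟙 ⌊ a? ⌋ ≡ 0
𝟙-⌊no⌋ (yes a) ¬a = ⊥-elim (¬a a)
𝟙-⌊no⌋ (no _)  _  = refl

𝟙-modular : ∀ c a b → 𝟙 (c ∧ (a ∨ b)) + 𝟙 (c ∧ (a ∧ b)) ≡ 𝟙 (c ∧ a) + 𝟙 (c ∧ b)
𝟙-modular false _     _     = refl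
𝟙-modular true  true  true  = refl
𝟙-modular true  true  false = refl
𝟙-modular true  false true  = refl
𝟙-modular true  false false = refl

count : ∀ {n} → (Fin n → Bool) → ℕ
count {n} p = ∑[ i < n ] 𝟙 (p i)

_<ᵇ_ : ∀ {n} → Fin n → Fin n → Bool
u <ᵇ v = ⌊ toℕ u <? toℕ v ⌋

pairCount : ∀ {n} → (Fin n × Fin n → Bool) → ℕ
pairCount {n} P = ∑[ u < n ] count (λ v → u <ᵇ v ∧ P (u , v))

count-mono : ∀ {n} {p q : Fin n → Bool} → p ⊆ q → count p ≤ count q
count-mono p⊆q = sum-mono-≤ (λ i → 𝟙-mono (p⊆q i))

count-modular-within : ∀ {n} (d p q : Fin n → Bool) →
  count (d ∩ (p ∪ q)) + count (d ∩ (p ∩ q)) ≡ count (d ∩ p) + count (d ∩ q)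
count-modular-within {n} d p q = begin
  count (d ∩ (p ∪ q)) + count (d ∩ (p ∩ q))                   ≡⟨ ∑-distrib-+ (𝟙 ∘ (d ∩ (p ∪ q))) (𝟙 ∘ (d ∩ (p ∩ q))) ⟨
  ∑[ i < n ] (𝟙 (d i ∧ (p i ∨ q i)) + 𝟙 (d i ∧ (p i ∧ q i))) ≡⟨ sum-cong-≗ (λ i → 𝟙-modular (d i) (p i) (q i)) ⟩
  ∑[ i < n ] (𝟙 (d i ∧ p i) + 𝟙 (d i ∧ q i))                 ≡⟨ ∑-distrib-+ (𝟙 ∘ (d ∩ p)) (𝟙 ∘ (d ∩ q)) ⟩
  count (d ∩ p) + count (d ∩ q)                               ∎
  where open ≡-Reasoning

count-modular : ∀ {n} (p q : Fin n → Bool) → count (p ∪ q) + count (p ∩ q) ≡ count p + count q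
count-modular = count-modular-within (λ _ → true)

count-∅ : ∀ {n} → count {n} ∅ ≡ 0
count-∅ {n} = sum-replicate-zero n

count-≟ : ∀ {n} (x : Fin n) → count (λ w → ⌊ x ≟ w ⌋) ≡ 1
count-≟ {suc n} x = trans (sum-single x (λ w w≢x → 𝟙-⌊no⌋ (x ≟ w) (w≢x ∘ sym))) (𝟙-⌊yes⌋ (x ≟ x) refl)

pairCount-modular : ∀ {n} (P Q : Fin n × Fin n → Bool) →
  pairCount (P ∪ Q) + pairCount (P ∩ Q) ≡ pairCount P + pairCount Q
pairCount-modular {n} P Q = begin
  pairCount (P ∪ Q) + pairCount (P ∩ Q)       ≡⟨ ∑-distrib-+ (row (P ∪ Q)) (row (P ∩ Q)) ⟨
  ∑[ u < n ] (row (P ∪ Q) u + row (P ∩ Q) u) ≡⟨ sum-cong-≗ (λ u → count-modular-within (u <ᵇ_) (P ∘ (u ,_)) (Q ∘ (u ,_))) ⟩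
  ∑[ u < n ] (row P u + row Q u)             ≡⟨ ∑-distrib-+ (row P) (row Q) ⟩
  pairCount P + pairCount Q                   ∎
  where
  open ≡-Reasoning
  row : (Fin n × Fin n → Bool) → Fin n → ℕ
  row R u = count ((u <ᵇ_) ∩ R ∘ (u ,_))

pairCount-mono : ∀ {n} {P Q : Fin n × Fin n → Bool} → P ⊆ Q → pairCount P ≤ pairCount Q
pairCount-mono {P = P} P⊆Q =
  sum-mono-≤ (λ u → count-mono (⊆-∩ (∩-⊆ˡ (u <ᵇ_) _) (λ v t → P⊆Q (u , v) (∩-⊆ʳ (u <ᵇ_) (P ∘ (u ,_)) v t))))

pairCount-∅ : ∀ {n} → pairCount {n} ∅ ≡ 0
pairCount-∅ {n} = sum-zero {f = λ u → count {n} (λ v → u <ᵇ v ∧ false)}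
  (λ u → trans (sum-cong-≗ (λ v → cong 𝟙 (∧-zeroʳ (u <ᵇ v)))) (count-∅ {n}))

sumL-tabulate : ∀ {A : Set} {n} (h : A → ℕ) (g : Fin n → A) → sumL h (tabulate g) ≡ sum (h ∘ g)
sumL-tabulate {n = zero}  h g = refl
sumL-tabulate {n = suc n} h g = cong (h (g zero) +_) (sumL-tabulate h (g ∘ suc))

anyL-tabulate : ∀ {A : Set} {n} (p : A → Bool) (g : Fin n → A) → anyL p (tabulate g) ≡ ⋁ (p ∘ g)
anyL-tabulate {n = zero}  p g = refl
anyL-tabulate {n = suc n} p g = cong (p (g zero) ∨_) (anyL-tabulate p (g ∘ suc))

countL≡sumL-𝟙 : ∀ {A : Set} (p : A → Bool) xs → countL p xs ≡ sumL (𝟙 ∘ p) xs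
countL≡sumL-𝟙 p []       = refl
countL≡sumL-𝟙 p (x ∷ xs) with p x
... | true  = cong suc (countL≡sumL-𝟙 p xs)
... | false = countL≡sumL-𝟙 p xs

anyL-allFin : ∀ {n} (p : Fin n → Bool) → anyL p (allFin n) ≡ ⋁ p
anyL-allFin p = anyL-tabulate p id

T-anyL-allFin⁺ : ∀ {n} (p : Fin n → Bool) i → T (p i) → T (anyL p (allFin n))
T-anyL-allFin⁺ p i t = subst T (sym (anyL-allFin p)) (⋁-intro p i t)

T-anyL-allFin⁻ : ∀ {n} (p : Fin n → Bool) → T (anyL p (allFin n)) → ∃ λ i → T (p i)
T-anyL-allFin⁻ p t = ⋁-elim p (subst T (anyL-allFin p) t)

countL-allFin : ∀ {n} (p : Fin n → Bool) → countL p (allFin n) ≡ count p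
countL-allFin {n} p = trans (countL≡sumL-𝟙 p (allFin n)) (sumL-tabulate (𝟙 ∘ p) id)

countPairs≡pairCount : ∀ n (p : Fin n → Fin n → Bool) → countPairs n p ≡ pairCount (uncurry p)
countPairs≡pairCount n p =
  trans (sumL-tabulate (λ u → countL (row u) (allFin n)) id) (sum-cong-≗ (countL-allFin ∘ row))
  where
  row : Fin n → Fin n → Bool
  row u v = u <ᵇ v ∧ p u v

-- Measures satisfying the modular law

module Modular {X : Set} (μ : (X → Bool) → ℕ)
  (μ-modular : ∀ p q → μ (p ∪ q) + μ (p ∩ q) ≡ μ p + μ q)
  (μ-mono : ∀ {p q} → p ⊆ q → μ p ≤ μ q)
  (μ-∅ : μ ∅ ≡ 0)
  where

  μ-∪-≤ : ∀ p q → μ (p ∪ q) ≤ μ p + μ q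
  μ-∪-≤ p q = ≤-trans (m≤m+n _ _) (≤-reflexive (μ-modular p q))

  μ-∪-overlap-≤ : ∀ p q {c} → c ≤ μ (p ∩ q) → μ (p ∪ q) + c ≤ μ p + μ q
  μ-∪-overlap-≤ p q c≤p∩q = ≤-trans (+-monoʳ-≤ (μ (p ∪ q)) c≤p∩q) (≤-reflexive (μ-modular p q))

  μ-∪-overlap-≥ : ∀ p q {c} → μ (p ∩ q) ≤ c → μ p + μ q ≤ μ (p ∪ q) + c
  μ-∪-overlap-≥ p q p∩q≤c = ≤-trans (≤-reflexive (sym (μ-modular p q))) (+-monoʳ-≤ (μ (p ∪ q)) p∩q≤c)

  μ-⋃-≤ : ∀ {k} (B : Fin k → X → Bool) → μ (⋃ B) ≤ ∑[ i < k ] μ (B i)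
  μ-⋃-≤ {zero}  B = ≤-reflexive μ-∅
  μ-⋃-≤ {suc k} B = ≤-trans (μ-∪-≤ (B zero) (⋃ (B ∘ suc))) (+-monoʳ-≤ _ (μ-⋃-≤ (B ∘ suc)))

  μ-∩-⋃-≤ : ∀ {k} A (B : Fin k → X → Bool) → μ (A ∩ ⋃ B) ≤ ∑[ i < k ] μ (A ∩ B i)
  μ-∩-⋃-≤ A B = ≤-trans (μ-mono (∩-⋃-⊆ A B)) (μ-⋃-≤ (λ i → A ∩ B i))

  μ-⋃-path-≤ : ∀ {m a c} (A : Fin (suc m) → X → Bool) → (∀ i → μ (A i) ≤ a) →
               (∀ (i : Fin m) → c ≤ μ (A (inject₁ i) ∩ A (suc i))) →
               μ (⋃ A) + m * c ≤ suc m * a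
  μ-⋃-path-≤ {zero} {a} A A≤a _ = begin
    μ (⋃ A) + 0        ≤⟨ +-monoˡ-≤ 0 (μ-⋃-≤ A) ⟩
    μ (A zero) + 0 + 0 ≡⟨ +-identityʳ _ ⟩
    μ (A zero) + 0     ≤⟨ +-monoˡ-≤ 0 (A≤a zero) ⟩
    a + 0              ∎
    where open ≤-Reasoning
  μ-⋃-path-≤ {suc m} {a} {c} A A≤a c≤overlap = begin
    μ (A₀ ∪ R) + (c + m * c) ≡⟨ +-assoc (μ (A₀ ∪ R)) c (m * c) ⟨
    μ (A₀ ∪ R) + c + m * c   ≤⟨ +-monoˡ-≤ (m * c) (μ-∪-overlap-≤ A₀ R c≤A₀∩R) ⟩
    μ A₀ + μ R + m * c       ≡⟨ +-assoc (μ A₀) (μ R) (m * c) ⟩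
    μ A₀ + (μ R + m * c)     ≤⟨ +-mono-≤ (A≤a zero) (μ-⋃-path-≤ (A ∘ suc) (A≤a ∘ suc) (c≤overlap ∘ suc)) ⟩
    a + suc m * a            ∎
    where
    open ≤-Reasoning
    A₀ R : X → Bool
    A₀ = A zero
    R = ⋃ (A ∘ suc)
    c≤A₀∩R : c ≤ μ (A₀ ∩ R)
    c≤A₀∩R = ≤-trans (c≤overlap zero)
      (μ-mono (⊆-∩ (∩-⊆ˡ A₀ _) (λ x t → ⊆-⋃ (A ∘ suc) zero x (∩-⊆ʳ A₀ (A (suc zero)) x t))))

  μ-⋃-path-≥ : ∀ {m a c} (A : Fin (suc m) → X → Bool) → (∀ i → a ≤ μ (A i)) →
               (∀ (i : Fin m) → μ (A (inject₁ i) ∩ A (suc i)) ≤ c) →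
               (∀ i j → suc (toℕ i) ℕ.< toℕ j → μ (A i ∩ A j) ≡ 0) →
               suc m * a ≤ μ (⋃ A) + m * c
  μ-⋃-path-≥ {zero} {a} A a≤A _ _ = begin
    a + 0          ≤⟨ +-monoˡ-≤ 0 (a≤A zero) ⟩
    μ (A zero) + 0 ≤⟨ +-monoˡ-≤ 0 (μ-mono (⊆-⋃ A zero)) ⟩
    μ (⋃ A) + 0    ∎
    where open ≤-Reasoning
  μ-⋃-path-≥ {suc m} {a} {c} A a≤A overlap≤c far≡0 = begin
    a + suc m * a            ≤⟨ +-mono-≤ (a≤A zero) tail-bound ⟩
    μ A₀ + (μ R + m * c)     ≡⟨ +-assoc (μ A₀) (μ R) (m * c) ⟨
    μ A₀ + μ R + m * c       ≤⟨ +-monoˡ-≤ (m * c) (μ-∪-overlap-≥ A₀ R A₀∩R≤c) ⟩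
    μ (A₀ ∪ R) + c + m * c   ≡⟨ +-assoc (μ (A₀ ∪ R)) c (m * c) ⟩
    μ (A₀ ∪ R) + (c + m * c) ∎
    where
    open ≤-Reasoning
    A₀ R : X → Bool
    A₀ = A zero
    R = ⋃ (A ∘ suc)
    tail-bound : suc m * a ≤ μ R + m * c
    tail-bound = μ-⋃-path-≥ (A ∘ suc) (a≤A ∘ suc) (overlap≤c ∘ suc) (λ i j → far≡0 (suc i) (suc j) ∘ s≤s)
    A₀∩R≤c : μ (A₀ ∩ R) ≤ c
    A₀∩R≤c = begin
      μ (A₀ ∩ R)                                                  ≤⟨ μ-∩-⋃-≤ A₀ (A ∘ suc) ⟩
      μ (A₀ ∩ A (suc zero)) + ∑[ j < m ] μ (A₀ ∩ A (suc (suc j))) ≡⟨ cong (μ (A₀ ∩ A (suc zero)) +_) (sum-zero (λ j → far≡0 zero (suc (suc j)) (s≤s (s≤s z≤n)))) ⟩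
      μ (A₀ ∩ A (suc zero)) + 0                                   ≡⟨ +-identityʳ _ ⟩
      μ (A₀ ∩ A (suc zero))                                       ≤⟨ overlap≤c zero ⟩
      c                                                           ∎

module VertexCount {N : ℕ} = Modular (count {N}) count-modular (count-mono {N}) (count-∅ {N})
module EdgeCount {N : ℕ} = Modular (pairCount {N}) pairCount-modular (pairCount-mono {N}) (pairCount-∅ {N})

count-≥-injection : ∀ {k n} (p : Fin n → Bool) (f : Fin k → Fin n) → Injective _≡_ _≡_ f →
                    (∀ i → T (p (f i))) → k ≤ count p
count-≥-injection {k} p f f-inj p∘f = begin
  k               ≡⟨ ∑-1 k ⟨
  ∑[ i < k ] 1    ≤⟨ sum-mono-≤ (λ i → 𝟙-mono {true} (λ _ → p∘f i)) ⟩
  sum (𝟙 ∘ p ∘ f) ≤⟨ sum-∘-injective-≤ (𝟙 ∘ p) f-inj ⟩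
  count p         ∎
  where open ≤-Reasoning

2≤count : ∀ {n} (p : Fin n → Bool) {x y} → x ≢ y → T (p x) → T (p y) → 2 ≤ count p
2≤count {n} p {x} {y} x≢y px py = count-≥-injection p points injective p∘points
  where
  points : Fin 2 → Fin n
  points zero       = x
  points (suc zero) = y
  injective : Injective _≡_ _≡_ points
  injective {zero}     {zero}     _  = refl
  injective {zero}     {suc zero} eq = ⊥-elim (x≢y eq)
  injective {suc zero} {zero}     eq = ⊥-elim (x≢y (sym eq))
  injective {suc zero} {suc zero} _  = refl
  p∘points : ∀ i → T (p (points i))
  p∘points zero       = px
  p∘points (suc zero) = py

3≤count : ∀ {n} (p : Fin n → Bool) {x y z} → x ≢ y → x ≢ z → y ≢ z →
          T (p x) → T (p y) → T (p z) → 3 ≤ count p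
3≤count {n} p {x} {y} {z} x≢y x≢z y≢z px py pz = count-≥-injection p points injective p∘points
  where
  points : Fin 3 → Fin n
  points zero             = x
  points (suc zero)       = y
  points (suc (suc zero)) = z
  injective : Injective _≡_ _≡_ points
  injective {zero}           {zero}           _  = refl
  injective {zero}           {suc zero}       eq = ⊥-elim (x≢y eq)
  injective {zero}           {suc (suc zero)} eq = ⊥-elim (x≢z eq)
  injective {suc zero}       {zero}           eq = ⊥-elim (x≢y (sym eq))
  injective {suc zero}       {suc zero}       _  = refl
  injective {suc zero}       {suc (suc zero)} eq = ⊥-elim (y≢z eq)
  injective {suc (suc zero)} {zero}           eq = ⊥-elim (x≢z (sym eq))
  injective {suc (suc zero)} {suc zero}       eq = ⊥-elim (y≢z (sym eq))
  injective {suc (suc zero)} {suc (suc zero)} _  = refl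
  p∘points : ∀ i → T (p (points i))
  p∘points zero             = px
  p∘points (suc zero)       = py
  p∘points (suc (suc zero)) = pz

3≤count-two-pairs : ∀ {n} (p : Fin n → Bool) {a b c d} → toℕ a ℕ.< toℕ b → toℕ c ℕ.< toℕ d →
                    ¬ (a ≡ c × b ≡ d) → T (p a) → T (p b) → T (p c) → T (p d) → 3 ≤ count p
3≤count-two-pairs p {a} {b} {c} {d} a<b c<d ab≢cd pa pb pc pd with a ≟ c | b ≟ c
... | yes refl | _        = 3≤count p (<⇒≢ᶠ a<b) (<⇒≢ᶠ c<d) (λ b≡d → ab≢cd (refl , b≡d)) pa pb pd
... | no _     | yes refl = 3≤count p (<⇒≢ᶠ a<b) (<⇒≢ᶠ (<-trans a<b c<d)) (<⇒≢ᶠ c<d) pa pb pd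
... | no a≢c   | no b≢c   = 3≤count p (<⇒≢ᶠ a<b) a≢c b≢c pa pb pc

orderedCount : ∀ {n} → (Fin n → Fin n → Bool) → ℕ
orderedCount {n} p = ∑[ u < n ] ∑[ v < n ] 𝟙 (p u v)

orderedCount≡2*pairCount : ∀ {n} (p : Fin n → Fin n → Bool) →
  (∀ u v → T (p u v) → T (p v u)) → (∀ u → ¬ T (p u u)) →
  orderedCount p ≡ 2 * pairCount (uncurry p)
orderedCount≡2*pairCount {n} p sym-p irrefl-p = begin
  orderedCount p                               ≡⟨ sum-cong-≗ (λ u → trans (sum-cong-≗ (split u)) (∑-distrib-+ (below u) (above u))) ⟩
  ∑[ u < n ] (sum (below u) + sum (above u))   ≡⟨ ∑-distrib-+ (sum ∘ below) (sum ∘ above) ⟩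
  c + ∑[ u < n ] ∑[ v < n ] 𝟙 (v <ᵇ u ∧ p v u) ≡⟨ cong (c +_) (∑-comm (λ u v → 𝟙 (v <ᵇ u ∧ p v u))) ⟩
  c + c                                        ≡⟨ cong (c +_) (+-identityʳ c) ⟨
  2 * c                                        ∎
  where
  open ≡-Reasoning
  c : ℕ
  c = pairCount (uncurry p)
  below above : Fin n → Fin n → ℕ
  below u v = 𝟙 (u <ᵇ v ∧ p u v)
  above u v = 𝟙 (v <ᵇ u ∧ p v u)
  split : ∀ u v → 𝟙 (p u v) ≡ below u v + above u v
  split u v with toℕ u <? toℕ v | toℕ v <? toℕ u
  ... | yes u<v | yes v<u = ⊥-elim (<-asym u<v v<u)
  ... | yes _   | no _    = sym (+-identityʳ _)
  ... | no _    | yes _   = 𝟙-cong (sym-p u v) (sym-p v u)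
  ... | no u≮v  | no v≮u with toℕ-injective (≤-antisym (≮⇒≥ v≮u) (≮⇒≥ u≮v))
  ...   | refl = n≤0⇒n≡0 (𝟙-mono {b = false} (irrefl-p u))

orderedCount-∘-injective-≤ : ∀ {m n} (q : Fin n → Fin n → Bool) {f : Fin m → Fin n} →
  Injective _≡_ _≡_ f → orderedCount (λ a b → q (f a) (f b)) ≤ orderedCount q
orderedCount-∘-injective-≤ {m} {n} q {f} f-inj = begin
  ∑[ a < m ] ∑[ b < m ] 𝟙 (q (f a) (f b)) ≤⟨ sum-mono-≤ (λ a → sum-∘-injective-≤ (𝟙 ∘ q (f a)) f-inj) ⟩
  ∑[ a < m ] ∑[ w < n ] 𝟙 (q (f a) w)     ≤⟨ sum-∘-injective-≤ (λ u → ∑[ w < n ] 𝟙 (q u w)) f-inj ⟩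
  orderedCount q                          ∎
  where open ≤-Reasoning

copyEdge : (F : Graph) {N : ℕ} → (Fin (n F) → Fin N) → Fin N × Fin N → Bool
copyEdge F φ = uncurry (copyAdj F φ)

module _ (F : Graph) {N : ℕ} (φ : Fin (n F) → Fin N) where

  copyAdj-image : ∀ {a b} → T (adj F a b) → T (copyAdj F φ (φ a) (φ b))
  copyAdj-image {a} {b} t =
    T-anyL-allFin⁺ _ a (T-anyL-allFin⁺ _ b (T-∧⁺ t (T-∧⁺ {⌊ φ a ≟ φ a ⌋} (fromWitness refl) (fromWitness refl))))

  copyAdj-preimage : ∀ {u v} → T (copyAdj F φ u v) →
                     ∃₂ λ a b → T (adj F a b) × φ a ≡ u × φ b ≡ v
  copyAdj-preimage {u} {v} t with T-anyL-allFin⁻ _ t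
  ... | a , tₐ with T-anyL-allFin⁻ _ tₐ
  ...   | b , tₐᵦ with T-∧⁻ (adj F a b) tₐᵦ
  ...     | adj-ab , t′ with T-∧⁻ ⌊ φ a ≟ u ⌋ t′
  ...       | φa≡u , φb≡v = a , b , adj-ab , toWitness φa≡u , toWitness φb≡v

  copyVtx-image : ∀ a → T (copyVtx F φ (φ a))
  copyVtx-image a = T-anyL-allFin⁺ _ a (fromWitness refl)

  copyAdj⇒copyVtx : ∀ {u v} → T (copyAdj F φ u v) → T (copyVtx F φ u) × T (copyVtx F φ v)
  copyAdj⇒copyVtx t with copyAdj-preimage t
  ... | a , b , _ , refl , refl = copyVtx-image a , copyVtx-image b

  copyAdj-sym : ∀ u v → T (copyAdj F φ u v) → T (copyAdj F φ v u)
  copyAdj-sym u v t with copyAdj-preimage t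
  ... | a , b , adj-ab , refl , refl = copyAdj-image (subst T (adj-sym F a b) adj-ab)

  copyAdj-irrefl : Injective _≡_ _≡_ φ → ∀ u → ¬ T (copyAdj F φ u u)
  copyAdj-irrefl φ-inj u t with copyAdj-preimage t
  ... | a , b , adj-ab , φa≡u , φb≡u with φ-inj (trans φa≡u (sym φb≡u))
  ...   | refl = subst T (adj-irr F a) adj-ab

  count-copyVtx-≤ : count (copyVtx F φ) ≤ n F
  count-copyVtx-≤ = begin
    count (copyVtx F φ)              ≡⟨ sum-cong-≗ (λ w → cong 𝟙 (anyL-allFin (λ a → singleton a w))) ⟩
    count (⋃ singleton)              ≤⟨ VertexCount.μ-⋃-≤ singleton ⟩
    ∑[ a < n F ] count (singleton a) ≡⟨ sum-cong-≗ (count-≟ ∘ φ) ⟩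
    ∑[ a < n F ] 1                   ≡⟨ ∑-1 (n F) ⟩
    n F                              ∎
    where
    open ≤-Reasoning
    singleton : Fin (n F) → Fin N → Bool
    singleton a w = ⌊ φ a ≟ w ⌋

  -- An injective map need not send increasing pairs to increasing pairs, so the edges are
  -- compared through ordered pairs, of which there are twice as many.
  edgeCount-≤-copy : Injective _≡_ _≡_ φ → edgeCount F ≤ pairCount (copyEdge F φ)
  edgeCount-≤-copy φ-inj = *-cancelˡ-≤ 2 (begin
    2 * edgeCount F                                ≡⟨ cong (2 *_) (countPairs≡pairCount (n F) (adj F)) ⟩
    2 * pairCount (uncurry (adj F))                ≡⟨ orderedCount≡2*pairCount (adj F) adj-symᵀ adj-irrᵀ ⟨
    orderedCount (adj F)                           ≤⟨ sum-mono-≤ {n F} (λ a → sum-mono-≤ {n F} (λ b → 𝟙-mono copyAdj-image)) ⟩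
    orderedCount (λ a b → copyAdj F φ (φ a) (φ b)) ≤⟨ orderedCount-∘-injective-≤ (copyAdj F φ) φ-inj ⟩
    orderedCount (copyAdj F φ)                     ≡⟨ orderedCount≡2*pairCount (copyAdj F φ) copyAdj-sym (copyAdj-irrefl φ-inj) ⟩
    2 * pairCount (copyEdge F φ)                   ∎)
    where
    open ≤-Reasoning
    adj-symᵀ : ∀ a b → T (adj F a b) → T (adj F b a)
    adj-symᵀ a b = subst T (adj-sym F a b)
    adj-irrᵀ : ∀ a → ¬ T (adj F a a)
    adj-irrᵀ a = subst T (adj-irr F a)

shared-edge : (F : Graph) {N : ℕ} (φ ψ : Fin (n F) → Fin N) → 0 ℕ.< commonEdges F φ ψ →
              ∃₂ λ u v → toℕ u ℕ.< toℕ v × T (copyAdj F φ u v) × T (copyAdj F ψ u v)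
shared-edge F {N} φ ψ 0<shared
  with sum-positive _ (subst (0 ℕ.<_) (countPairs≡pairCount N (λ u v → copyAdj F φ u v ∧ copyAdj F ψ u v)) 0<shared)
... | u , 0<row with sum-positive _ 0<row
...   | v , 0<𝟙 with T-∧⁻ (u <ᵇ v) (𝟙-positive 0<𝟙)
...     | u<v , t with T-∧⁻ (copyAdj F φ u v) t
...       | tφ , tψ = u , v , toWitness u<v , tφ , tψ

2≤count-shared-vertices : (F : Graph) {N : ℕ} (φ ψ : Fin (n F) → Fin N) → 0 ℕ.< commonEdges F φ ψ →
                          2 ≤ count (copyVtx F φ ∩ copyVtx F ψ)
2≤count-shared-vertices F φ ψ 0<shared with shared-edge F φ ψ 0<shared
... | u , v , u<v , tφ , tψ with copyAdj⇒copyVtx F φ tφ | copyAdj⇒copyVtx F ψ tψ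
...   | uφ , vφ | uψ , vψ = 2≤count (copyVtx F φ ∩ copyVtx F ψ) (<⇒≢ᶠ u<v) (T-∧⁺ uφ uψ) (T-∧⁺ vφ vψ)

unionVertices≡count-⋃ : (F : Graph) {N ℓ : ℕ} (f : Fin ℓ → Fin (n F) → Fin N) →
                        unionVertices F f ≡ count (⋃ (λ i → copyVtx F (f i)))
unionVertices≡count-⋃ F {N} {ℓ} f =
  trans (countL-allFin (λ w → anyL (λ i → copyVtx F (f i) w) (allFin ℓ)))
        (sum-cong-≗ (λ w → cong 𝟙 (anyL-allFin (λ i → copyVtx F (f i) w))))

unionEdges≡pairCount-⋃ : (F : Graph) {N ℓ : ℕ} (f : Fin ℓ → Fin (n F) → Fin N) →
                         unionEdges F f ≡ pairCount (⋃ (λ i → copyEdge F (f i)))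
unionEdges≡pairCount-⋃ F {N} f = trans (countPairs≡pairCount N _)
  (sum-cong-≗ (λ u → sum-cong-≗ (λ v → cong (λ b → 𝟙 (u <ᵇ v ∧ b)) (anyL-allFin (λ i → copyAdj F (f i) u v)))))

commonEdges≡pairCount-∩ : (F : Graph) {N : ℕ} (φ ψ : Fin (n F) → Fin N) →
                          commonEdges F φ ψ ≡ pairCount (copyEdge F φ ∩ copyEdge F ψ)
commonEdges≡pairCount-∩ F {N} φ ψ = countPairs≡pairCount N _

-- The d₂ inequality

*<*⇒/< : ∀ {x y p q} → x ℤ.* ℤ.+ suc q ℤ.< y ℤ.* ℤ.+ suc p → x / suc p < y / suc q
*<*⇒/< {x} {y} {p} {q} xq<yp = toℚᵘ-cancel-<
  (<-respˡ-≃ (≃-sym (toℚᵘ-fromℚᵘ (mkℚᵘ x p))) (<-respʳ-≃ (≃-sym (toℚᵘ-fromℚᵘ (mkℚᵘ y q))) (*<* xq<yp)))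

/<⇒*<* : ∀ {x y p q} → x / suc p < y / suc q → x ℤ.* ℤ.+ suc q ℤ.< y ℤ.* ℤ.+ suc p
/<⇒*<* {x} {y} {p} {q} x/p<y/q
  with <-respˡ-≃ (toℚᵘ-fromℚᵘ (mkℚᵘ x p)) (<-respʳ-≃ (toℚᵘ-fromℚᵘ (mkℚᵘ y q)) (toℚᵘ-mono-< x/p<y/q))
... | *<* xq<yp = xq<yp

ℕ-*<*⇒/< : ∀ {x y p q} → x * suc q ℕ.< y * suc p → ℤ.+ x / suc p < ℤ.+ y / suc q
ℕ-*<*⇒/< {x} {y} {p} {q} xq<yp =
  *<*⇒/< {ℤ.+ x} {ℤ.+ y} {p} {q} (subst₂ ℤ._<_ (pos-* x (suc q)) (pos-* y (suc p)) (+<+ xq<yp))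

/<⇒ℕ-*<* : ∀ {x y p q} → ℤ.+ x / suc p < ℤ.+ y / suc q → x * suc q ℕ.< y * suc p
/<⇒ℕ-*<* {x} {y} {p} {q} x/p<y/q =
  drop‿+<+ (subst₂ ℤ._<_ (sym (pos-* x (suc q))) (sym (pos-* y (suc p))) (/<⇒*<* {ℤ.+ x} {ℤ.+ y} {p} {q} x/p<y/q))

-- With |V(F)| = 3 + b, |E(F)| = 1 + e, |V(C)| = 3 + c and |E(C)| = 1 + E, this is
-- d₂(F) < d₂(C) with the denominators cleared.
cross-multiplied : ∀ {b c e E ℓ} → suc b ℕ.< e → 2 + c ≤ ℓ * suc b → ℓ * e ≤ suc E → e * suc c ℕ.< E * suc b
cross-multiplied {b} {c} {e} {E} {ℓ} b<e c+2≤ℓb ℓe≤E+1 = +-cancelʳ-< e (e * suc c) (E * suc b) (begin-strict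
  e * suc c + e     ≡⟨ solve (e ∷ c ∷ []) ⟩
  e * (2 + c)       ≤⟨ *-monoʳ-≤ e c+2≤ℓb ⟩
  e * (ℓ * suc b)   ≡⟨ solve (e ∷ ℓ ∷ b ∷ []) ⟩
  ℓ * e * suc b     ≤⟨ *-monoˡ-≤ (suc b) ℓe≤E+1 ⟩
  suc E * suc b     ≡⟨ +-comm (suc b) (E * suc b) ⟩
  E * suc b + suc b <⟨ +-monoʳ-< (E * suc b) b<e ⟩
  E * suc b + e     ∎)
  where open ≤-Reasoning

frac<d₂ : ∀ {b c e E ℓ} → suc b ℕ.< e → 2 + c ≤ ℓ * suc b → ℓ * e ≤ E → ℤ.+ e / suc b < d₂ (3 + c) E
frac<d₂ {E = zero} {ℓ = ℓ} b<e c+2≤ℓb ℓe≤0 with ≤-trans c+2≤ℓb (≤-trans (*-monoʳ-≤ ℓ (<⇒≤ b<e)) ℓe≤0)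
... | ()
frac<d₂ {b} {c} {e} {suc E} {ℓ} b<e c+2≤ℓb ℓe≤E =
  ℕ-*<*⇒/< {e} {E} {b} {c} (cross-multiplied {b} {c} {e} {E} {ℓ} b<e c+2≤ℓb ℓe≤E)

d₂-< : ∀ {v e V E ℓ} → 1ℚ < d₂ v e → 3 ≤ V → V + 2 * ℓ ≤ ℓ * v + 1 → ℓ * e ≤ E + ℓ → d₂ v e < d₂ V E
d₂-< {0} 1<1 = ⊥-elim (<-irreflℚ refl 1<1)
d₂-< {1} 1<1 = ⊥-elim (<-irreflℚ refl 1<1)
d₂-< {2} 1<1 = ⊥-elim (<-irreflℚ refl 1<1)
d₂-< {suc (suc (suc b))} {zero} 1<d₂ with /<⇒*<* {ℤ.+ 1} { -[1+ 0 ] } {0} {b} 1<d₂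
... | ()
d₂-< {suc (suc (suc b))} {suc e} {1} _ (s≤s ())
d₂-< {suc (suc (suc b))} {suc e} {2} _ (s≤s (s≤s ()))
d₂-< {suc (suc (suc b))} {suc e} {suc (suc (suc c))} {E} {ℓ} 1<d₂ _ V-bound E-bound =
  frac<d₂ {b} {c} {e} {E} {ℓ} b<e c+2≤ℓb ℓe≤E
  where
  b<e : suc b ℕ.< e
  b<e = subst₂ ℕ._<_ (*-identityˡ (suc b)) (*-identityʳ e) (/<⇒ℕ-*<* {1} {e} {0} {b} 1<d₂)
  c+2≤ℓb : 2 + c ≤ ℓ * suc b
  c+2≤ℓb = +-cancelʳ-≤ (1 + 2 * ℓ) (2 + c) (ℓ * suc b) (begin
    2 + c + (1 + 2 * ℓ)     ≡⟨ solve (c ∷ ℓ ∷ []) ⟩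
    3 + c + 2 * ℓ           ≤⟨ V-bound ⟩
    ℓ * (3 + b) + 1         ≡⟨ solve (ℓ ∷ b ∷ []) ⟩
    ℓ * suc b + (1 + 2 * ℓ) ∎)
    where open ≤-Reasoning
  ℓe≤E : ℓ * e ≤ E
  ℓe≤E = +-cancelˡ-≤ ℓ (ℓ * e) E (begin
    ℓ + ℓ * e ≡⟨ *-suc ℓ e ⟨
    ℓ * suc e ≤⟨ E-bound ⟩
    E + ℓ     ≡⟨ +-comm E ℓ ⟩
    ℓ + E     ∎)
    where open ≤-Reasoning

-- The cycle of copies

module Cycle (F : Graph) (m N : ℕ) (φ : Fin (3 + m) → Embedding F N)
  (no-edge-in-three : ∀ i j k → i ≢ j → j ≢ k → i ≢ k → ∀ u v
     → (copyAdj F (proj₁ (φ i)) u v ∧ copyAdj F (proj₁ (φ j)) u v ∧ copyAdj F (proj₁ (φ k)) u v) ≡ false)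
  (adjacent-share-one : ∀ i j → i ≢ j → CycAdj (3 + m) i j → commonEdges F (proj₁ (φ i)) (proj₁ (φ j)) ≡ 1)
  (others-share-none : ∀ i j → i ≢ j → ¬ CycAdj (3 + m) i j → commonEdges F (proj₁ (φ i)) (proj₁ (φ j)) ≡ 0)
  where

  ℓ : ℕ
  ℓ = 3 + m

  copy : Fin ℓ → Fin (n F) → Fin N
  copy i = proj₁ (φ i)

  V : Fin ℓ → Fin N → Bool
  V i = copyVtx F (copy i)

  E : Fin ℓ → Fin N × Fin N → Bool
  E i = copyEdge F (copy i)

  V-tail : Fin N → Bool
  V-tail = ⋃ (V ∘ suc)

  E-tail : Fin N × Fin N → Bool
  E-tail = ⋃ (E ∘ suc)

  last : Fin ℓ
  last = fromℕ (2 + m)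

  share-one-consecutive : ∀ (i : Fin (2 + m)) → commonEdges F (copy (inject₁ i)) (copy (suc i)) ≡ 1
  share-one-consecutive i = adjacent-share-one (inject₁ i) (suc i) i≢i+1 (inj₁ (inj₁ i+1≡1+i))
    where
    i+1≡1+i : toℕ (suc i) ≡ suc (toℕ (inject₁ i))
    i+1≡1+i = cong suc (sym (toℕ-inject₁ i))
    i≢i+1 : inject₁ i ≢ suc i
    i≢i+1 eq = 1+n≢n (trans (sym i+1≡1+i) (cong toℕ (sym eq)))

  share-one-wrap : commonEdges F (copy zero) (copy last) ≡ 1
  share-one-wrap = adjacent-share-one zero last (λ ()) (inj₂ (inj₂ (cong suc (toℕ-fromℕ (2 + m)) , refl)))

  share-none-tail : ∀ (i j : Fin (2 + m)) → suc (toℕ i) ℕ.< toℕ j →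
                    commonEdges F (copy (suc i)) (copy (suc j)) ≡ 0
  share-none-tail i j i+1<j = others-share-none (suc i) (suc j) i≢j not-adjacent
    where
    i<j : toℕ i ℕ.< toℕ j
    i<j = <-trans (n<1+n (toℕ i)) i+1<j
    i≢j : suc i ≢ suc j
    i≢j refl = <-irrefl refl i<j
    not-adjacent : ¬ CycAdj ℓ (suc i) (suc j)
    not-adjacent (inj₁ (inj₁ j≡i+1))  = <-irrefl (sym (suc-injective j≡i+1)) i+1<j
    not-adjacent (inj₁ (inj₂ (_ , ())))
    not-adjacent (inj₂ (inj₁ i≡j+1))  = <-asym (subst (toℕ j ℕ.<_) (sym (suc-injective i≡j+1)) (n<1+n (toℕ j))) i<j
    not-adjacent (inj₂ (inj₂ (_ , ())))

  share-none-with-zero : ∀ (j : Fin (1 + m)) → j ≢ fromℕ m → commonEdges F (copy zero) (copy (suc (suc j))) ≡ 0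
  share-none-with-zero j j≢m = others-share-none zero (suc (suc j)) (λ ()) not-adjacent
    where
    not-adjacent : ¬ CycAdj ℓ zero (suc (suc j))
    not-adjacent (inj₁ (inj₁ ()))
    not-adjacent (inj₁ (inj₂ (() , _)))
    not-adjacent (inj₂ (inj₁ ()))
    not-adjacent (inj₂ (inj₂ (j+3≡ℓ , _))) =
      j≢m (toℕ-injective (trans (suc-injective (suc-injective (suc-injective j+3≡ℓ))) (sym (toℕ-fromℕ m))))

  2≤overlap-V : ∀ (i : Fin (2 + m)) → 2 ≤ count (V (inject₁ i) ∩ V (suc i))
  2≤overlap-V i = 2≤count-shared-vertices F (copy (inject₁ i)) (copy (suc i)) (≤-reflexive (sym (share-one-consecutive i)))

  endpoints∈V₀∩V-tail : ∀ i {u v} → T (copyAdj F (copy zero) u v) → T (copyAdj F (copy (suc i)) u v) →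
                        T ((V zero ∩ V-tail) u) × T ((V zero ∩ V-tail) v)
  endpoints∈V₀∩V-tail i uv∈₀ uv∈ᵢ with copyAdj⇒copyVtx F (copy zero) uv∈₀ | copyAdj⇒copyVtx F (copy (suc i)) uv∈ᵢ
  ... | u∈₀ , v∈₀ | u∈ᵢ , v∈ᵢ = T-∧⁺ u∈₀ (⊆-⋃ (V ∘ suc) i _ u∈ᵢ) , T-∧⁺ v∈₀ (⊆-⋃ (V ∘ suc) i _ v∈ᵢ)

  3≤overlap-V₀ : 3 ≤ count (V zero ∩ V-tail)
  3≤overlap-V₀ = from-edges
    (shared-edge F (copy zero) (copy (suc zero)) (≤-reflexive (sym (share-one-consecutive zero))))
    (shared-edge F (copy zero) (copy last) (≤-reflexive (sym share-one-wrap)))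
    where
    from-edges : (∃₂ λ u v → toℕ u ℕ.< toℕ v × T (copyAdj F (copy zero) u v) × T (copyAdj F (copy (suc zero)) u v)) →
                 (∃₂ λ u v → toℕ u ℕ.< toℕ v × T (copyAdj F (copy zero) u v) × T (copyAdj F (copy last) u v)) →
                 3 ≤ count (V zero ∩ V-tail)
    from-edges (a , b , a<b , ab∈₀ , ab∈₁) (c , d , c<d , cd∈₀ , cd∈ₗ) =
      3≤count-two-pairs (V zero ∩ V-tail) a<b c<d distinct
        (proj₁ ab∈) (proj₂ ab∈) (proj₁ cd∈) (proj₂ cd∈)
      where
      ab∈ : T ((V zero ∩ V-tail) a) × T ((V zero ∩ V-tail) b)
      ab∈ = endpoints∈V₀∩V-tail zero ab∈₀ ab∈₁
      cd∈ : T ((V zero ∩ V-tail) c) × T ((V zero ∩ V-tail) d)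
      cd∈ = endpoints∈V₀∩V-tail (fromℕ (1 + m)) cd∈₀ cd∈ₗ
      distinct : ¬ (a ≡ c × b ≡ d)
      distinct (refl , refl) = subst T (no-edge-in-three zero (suc zero) last (λ ()) (λ ()) (λ ()) a b)
                                       (T-∧⁺ ab∈₀ (T-∧⁺ ab∈₁ cd∈ₗ))

  3≤unionVertices : 3 ≤ unionVertices F copy
  3≤unionVertices = begin
    3                        ≤⟨ 3≤overlap-V₀ ⟩
    count (V zero ∩ V-tail)  ≤⟨ count-mono (λ w → ⊆-⋃ V zero w ∘ ∩-⊆ˡ (V zero) V-tail w) ⟩
    count (⋃ V)              ≡⟨ unionVertices≡count-⋃ F copy ⟨
    unionVertices F copy     ∎
    where open ≤-Reasoning

  unionVertices-bound : unionVertices F copy + 2 * ℓ ≤ ℓ * n F + 1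
  unionVertices-bound = begin
    unionVertices F copy + 2 * ℓ                      ≡⟨ cong (_+ 2 * ℓ) (unionVertices≡count-⋃ F copy) ⟩
    count (⋃ V) + 2 * ℓ                               ≡⟨ regroup (count (⋃ V)) m ⟩
    count (⋃ V) + 3 + (1 + m) * 2 + 1                 ≤⟨ +-monoˡ-≤ 1 (+-monoˡ-≤ ((1 + m) * 2) (VertexCount.μ-∪-overlap-≤ (V zero) V-tail 3≤overlap-V₀)) ⟩
    count (V zero) + count V-tail + (1 + m) * 2 + 1   ≡⟨ cong (_+ 1) (+-assoc (count (V zero)) (count V-tail) ((1 + m) * 2)) ⟩
    count (V zero) + (count V-tail + (1 + m) * 2) + 1 ≤⟨ +-monoˡ-≤ 1 (+-mono-≤ (count-copyVtx-≤ F (copy zero)) tail-bound) ⟩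
    ℓ * n F + 1                                       ∎
    where
    open ≤-Reasoning
    regroup : ∀ x m → x + 2 * (3 + m) ≡ x + 3 + (1 + m) * 2 + 1
    regroup = solve-∀
    tail-bound : count V-tail + (1 + m) * 2 ≤ (2 + m) * n F
    tail-bound = VertexCount.μ-⋃-path-≤ (V ∘ suc) (λ i → count-copyVtx-≤ F (copy (suc i))) (2≤overlap-V ∘ suc)

  overlap-E : ∀ i j → pairCount (E i ∩ E j) ≡ commonEdges F (copy i) (copy j)
  overlap-E i j = sym (commonEdges≡pairCount-∩ F (copy i) (copy j))

  overlap-E₀≤2 : pairCount (E zero ∩ E-tail) ≤ 2
  overlap-E₀≤2 = begin
    pairCount (E zero ∩ E-tail)                                 ≤⟨ EdgeCount.μ-∩-⋃-≤ (E zero) (E ∘ suc) ⟩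
    overlap₀ (suc zero) + ∑[ j < 1 + m ] overlap₀ (suc (suc j)) ≡⟨ cong (overlap₀ (suc zero) +_) (sum-single {f = λ j → overlap₀ (suc (suc j))} (fromℕ m) only-last) ⟩
    overlap₀ (suc zero) + overlap₀ last                         ≡⟨ cong₂ _+_ (trans (overlap-E _ _) (share-one-consecutive zero)) (trans (overlap-E _ _) share-one-wrap) ⟩
    2                                                           ∎
    where
    open ≤-Reasoning
    overlap₀ : Fin ℓ → ℕ
    overlap₀ i = pairCount (E zero ∩ E i)
    only-last : ∀ j → j ≢ fromℕ m → overlap₀ (suc (suc j)) ≡ 0
    only-last j j≢m = trans (overlap-E _ _) (share-none-with-zero j j≢m)

  unionEdges-bound : ℓ * edgeCount F ≤ unionEdges F copy + ℓ
  unionEdges-bound = begin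
    ℓ * edgeCount F                                       ≤⟨ +-mono-≤ (edgeCount-≤-copy F (copy zero) (proj₂ (φ zero))) tail-bound ⟩
    pairCount (E zero) + (pairCount E-tail + (1 + m) * 1) ≡⟨ +-assoc (pairCount (E zero)) (pairCount E-tail) ((1 + m) * 1) ⟨
    pairCount (E zero) + pairCount E-tail + (1 + m) * 1   ≤⟨ +-monoˡ-≤ ((1 + m) * 1) (EdgeCount.μ-∪-overlap-≥ (E zero) E-tail overlap-E₀≤2) ⟩
    pairCount (⋃ E) + 2 + (1 + m) * 1                     ≡⟨ regroup (pairCount (⋃ E)) m ⟩
    pairCount (⋃ E) + ℓ                                   ≡⟨ cong (_+ ℓ) (unionEdges≡pairCount-⋃ F copy) ⟨
    unionEdges F copy + ℓ                                 ∎
    where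
    open ≤-Reasoning
    regroup : ∀ x m → x + 2 + (1 + m) * 1 ≡ x + (3 + m)
    regroup = solve-∀
    tail-bound : (2 + m) * edgeCount F ≤ pairCount E-tail + (1 + m) * 1
    tail-bound = EdgeCount.μ-⋃-path-≥ (E ∘ suc) (λ i → edgeCount-≤-copy F (copy (suc i)) (proj₂ (φ (suc i))))
      (λ i → ≤-reflexive (trans (overlap-E _ _) (share-one-consecutive (suc i))))
      (λ i j → trans (overlap-E _ _) ∘ share-none-tail i j)

proposition5p4 : (F : Graph) → 1ℚ < d₂G F → (ℓ : ℕ) → 3 ≤ ℓ → (N : ℕ)
  → (φ : Fin ℓ → Embedding F N)
  → (∀ i j k → i ≢ j → j ≢ k → i ≢ k → ∀ u v
       → (copyAdj F (proj₁ (φ i)) u v ∧ copyAdj F (proj₁ (φ j)) u v ∧ copyAdj F (proj₁ (φ k)) u v) ≡ false)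
  → (∀ i j → i ≢ j → CycAdj ℓ i j → commonEdges F (proj₁ (φ i)) (proj₁ (φ j)) ≡ 1)
  → (∀ i j → i ≢ j → ¬ CycAdj ℓ i j → commonEdges F (proj₁ (φ i)) (proj₁ (φ j)) ≡ 0)
  → d₂G F < d₂ (unionVertices F (λ i → proj₁ (φ i))) (unionEdges F (λ i → proj₁ (φ i)))
proposition5p4 F _ 1 (s≤s ())
proposition5p4 F _ 2 (s≤s (s≤s ()))
proposition5p4 F 1<d₂F (suc (suc (suc m))) _ N φ no-edge-in-three adjacent-share-one others-share-none =
  d₂-< {n F} {edgeCount F} 1<d₂F 3≤unionVertices unionVertices-bound unionEdges-bound
  where open Cycle F m N φ no-edge-in-three adjacent-share-one others-share-none
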